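{- Exponential merging of two sorted sequences $A=(a_1,\dots,a_n)$ and $B=(b_1,\dots,b_n)$ has a worst-case fragile complexity of $O(\log n)$: every element participates in $O(\log n)$ comparisons.
   Context: Elements come from a totally ordered set and are accessed only through comparisons. Exponential merging of sorted sequences $A=(a_1,\dots,a_n)$ and $B=(b_1,\dots,b_m)$: if either is empty, output the other and stop. Otherwise (padding $B$ conceptually with virtual elements larger than $a_1$ so that its length is a power of two and some $b_i>a_1$ exists), perform an exponential search on $B$ starting at $b_1$: a doubling phase compares $a_1$ with $b_{2^0},b_{2^1},b_{2^2},\dots$ to find the smallest $k$ with $a_1<b_{2^k}$, followed by a binary search between $b_{2^{k-1}}$ and $b_{2^k}$ to find the largest $\ell$ with $b_\ell<a_1$. Output $b_1,\dots,b_\ell,a_1$ and recurse on $(b_{\ell+1},\dots,b_m)$ and $(a_2,\dots,a_n)$, with the roles of the two sequences swapped. -}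

module Defs where

open import Level using (0ℓ)
open import Data.Bool using (Bool; true; false; _∨_; if_then_else_)
open import Data.Nat using (ℕ; zero; suc; _+_; _*_; _∸_; _≤ᵇ_; _/_)
open import Data.Sum using (_⊎_; inj₁; inj₂)
open import Data.Sum.Properties using (≡-dec)
open import Data.Product using (_×_; _,_; proj₁; proj₂)
open import Data.Maybe using (Maybe; just; nothing)
open import Data.List using (List; []; _∷_; _++_; length; take; drop; [_])
open import Data.List.Relation.Unary.All using (All)
open import Data.List.Relation.Unary.Linked using (Linked)
open import Relation.Binary.Bundles using (StrictTotalOrder)
open import Relation.Binary.Definitions using (tri<; tri≈; tri>)
open import Relation.Nullary using (¬_; does; Dec)
open import Relation.Binary.PropositionalEquality using (_≡_)
import Data.Nat.Properties as ℕP

-- Elements are identified by their position: inj₁ i is a_(i+1), inj₂ j is b_(j+1).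
Label : Set
Label = ℕ ⊎ ℕ

_≟L_ : (x y : Label) → Dec (x ≡ y)
_≟L_ = ≡-dec ℕP._≟_ ℕP._≟_

module Merge (O : StrictTotalOrder 0ℓ 0ℓ 0ℓ) where
  open StrictTotalOrder O renaming (Carrier to C)

  E : Set
  E = Label × C

  Cmp : Set
  Cmp = Label × Label

  lt? : C → C → Bool
  lt? x y with compare x y
  ... | tri< _ _ _ = true
  ... | tri≈ _ _ _ = false
  ... | tri> _ _ _ = false

  -- 1-based access; positions beyond the list are the virtual padding
  -- elements (larger than the searched element; no comparison performed).
  at : List E → ℕ → Maybe E
  at []       _             = nothing
  at (_ ∷ _)  zero          = nothing
  at (b ∷ _)  (suc zero)    = just b
  at (_ ∷ bs) (suc (suc i)) = at bs (suc i)

  doubling : ℕ → E → List E → ℕ → ℕ × List Cmp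
  doubling zero     e bs p = p , []
  doubling (suc f)  e bs p with at bs p
  ... | nothing = p , []
  ... | just b with lt? (proj₂ e) (proj₂ b)
  ...   | true  = p , [ (proj₁ e , proj₁ b) ]
  ...   | false with doubling f e bs (p + p)
  ...     | (q , cs) = q , ((proj₁ e , proj₁ b) ∷ cs)

  -- Binary search: invariant b_lo < x < b_hi; returns the largest ℓ with b_ℓ < x.
  binary : ℕ → E → List E → ℕ → ℕ → ℕ × List Cmp
  binary zero    e bs lo hi = lo , []
  binary (suc f) e bs lo hi =
    if (hi ∸ lo) ≤ᵇ 1 then (lo , []) else step (at bs mid)
    where
      mid : ℕ
      mid = (lo + hi) / 2
      step : Maybe E → ℕ × List Cmp
      step nothing = binary f e bs lo mid
      step (just b) with lt? (proj₂ e) (proj₂ b)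
      ... | true  with binary f e bs lo mid
      ...   | (r , cs) = r , ((proj₁ e , proj₁ b) ∷ cs)
      step (just b) | false with binary f e bs mid hi
      ...   | (r , cs) = r , ((proj₁ e , proj₁ b) ∷ cs)

  expSearch : E → List E → ℕ × List Cmp
  expSearch e bs with doubling (suc (length bs)) e bs 1
  ... | (1 , cs) = 0 , cs
  ... | (p , cs) with binary p e bs (p / 2) p
  ...   | (ℓ , cs′) = ℓ , (cs ++ cs′)

  -- Returns the merged output and the list of all comparisons performed.
  -- (The ℕ argument is fuel; length as + length bs suffices.)
  expMerge′ : ℕ → List E → List E → List E × List Cmp
  expMerge′ _       []       bs       = bs , []
  expMerge′ _       (a ∷ as) []       = (a ∷ as) , []
  expMerge′ zero    (a ∷ as) (b ∷ bs) = (a ∷ as) ++ (b ∷ bs) , []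
  expMerge′ (suc f) (a ∷ as) (b ∷ bs) with expSearch a (b ∷ bs)
  ... | (ℓ , cs) with expMerge′ f (drop ℓ (b ∷ bs)) as
  ...   | (out , cs′) = take ℓ (b ∷ bs) ++ (a ∷ out) , (cs ++ cs′)

  label : (ℕ → Label) → ℕ → List C → List E
  label t i []       = []
  label t i (x ∷ xs) = (t i , x) ∷ label t (suc i) xs

  expMerge : List C → List C → List E × List Cmp
  expMerge A B = expMerge′ (length A + length B) (label inj₁ 0 A) (label inj₂ 0 B)

  participations : Label → List Cmp → ℕ
  participations l [] = 0
  participations l ((x , y) ∷ cs) =
    (if does (l ≟L x) ∨ does (l ≟L y) then 1 else 0) + participations l cs

  comparisonsOf : Label → List C → List C → ℕ
  comparisonsOf l A B = participations l (proj₂ (expMerge A B))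

  Disjoint : List C → List C → Set
  Disjoint A B = All (λ x → All (λ y → ¬ (x ≈ y)) B) A

{-# OPTIONS --safe #-}
-- Fix an element l and pay for its comparisons from a potential. If l is the head a being
-- searched, the exponential search costs it at most L = O(log n) comparisons. Otherwise, if the
-- search returns ℓ, each of its two phases probes a position of B at most once and never beyond
-- position 2ℓ + 1, so l is probed at most twice, and only if it lies among the first 2ℓ + 1
-- elements. The ℓ elements before it are then output, so its position halves, and a potential
-- 2 log₂ (position) + L + 2 in the searched sequence (L at the head of the other one) releases
-- enough to pay for the probes. The initial potential is O(log n).

module Submission where

open import Defs
open import Level using (0ℓ)
open import Function using (_∘_)
open import Function.Definitions using (Injective)
open import Data.Bool using (true; false; if_then_else_; _∨_)
open import Data.Unit using (⊤)
open import Data.Nat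
open import Data.Nat.Properties
open import Data.Nat.DivMod using (m/n≡1+[m∸n]/n)
open import Data.Nat.Logarithm using (⌊log₂_⌋; ⌊log₂⌋-mono-≤; ⌊log₂[2^n]⌋≡n; ⌊log₂[2*b]⌋≡1+⌊log₂b⌋)
open import Data.Nat.Tactic.RingSolver using (solve-∀)
open import Data.Product using (Σ; _×_; _,_; proj₁; proj₂)
open import Data.Sum using (_⊎_; inj₁; inj₂)
open import Data.Sum.Properties using (inj₁-injective; inj₂-injective)
open import Data.Maybe using (just; nothing)
open import Data.List using (List; []; _∷_; _++_; length; drop)
open import Data.List.Properties using (length-++; ++-identityʳ; length-drop)
open import Data.List.Relation.Unary.Linked using (Linked)
open import Relation.Nullary using (¬_; does; yes; no)
open import Relation.Nullary.Negation using (contradiction)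
open import Relation.Binary.Bundles using (StrictTotalOrder)
open import Relation.Binary.PropositionalEquality
open import Algebra.Properties.CommutativeSemigroup +-commutativeSemigroup using (interchange)
open ≤-Reasoning

-- Indicator of the interval [a, b) of 1-based positions, evaluated at the 0-based index i.
𝟙[_,_⟩ : ℕ → ℕ → ℕ → ℕ
𝟙[ a , b ⟩ i with a ≤? suc i | suc i <? b
... | yes _ | yes _ = 1
... | _     | _     = 0

𝟙-in : ∀ {a b i} → a ≤ suc i → suc i < b → 𝟙[ a , b ⟩ i ≡ 1
𝟙-in {a} {b} {i} a≤ <b with a ≤? suc i | suc i <? b
... | yes _   | yes _  = refl
... | no a≰   | _      = contradiction a≤ a≰
... | yes _   | no ≮b  = contradiction <b ≮b

𝟙-cases : ∀ a b i → 𝟙[ a , b ⟩ i ≡ 0 ⊎ (a ≤ suc i × suc i < b)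
𝟙-cases a b i with a ≤? suc i | suc i <? b
... | yes a≤ | yes <b = inj₂ (a≤ , <b)
... | yes _  | no _   = inj₁ refl
... | no _   | _      = inj₁ refl

𝟙≤1 : ∀ a b i → 𝟙[ a , b ⟩ i ≤ 1
𝟙≤1 a b i with 𝟙-cases a b i
... | inj₁ eq         = ≤-trans (≤-reflexive eq) z≤n
... | inj₂ (a≤ , <b)  = ≤-reflexive (𝟙-in a≤ <b)

𝟙-outˡ : ∀ {a b i} → suc i < a → 𝟙[ a , b ⟩ i ≡ 0
𝟙-outˡ {a} {b} {i} <a with 𝟙-cases a b i
... | inj₁ eq         = eq
... | inj₂ (a≤ , _)   = contradiction a≤ (<⇒≱ <a)

𝟙-outʳ : ∀ {a b i} → b ≤ suc i → 𝟙[ a , b ⟩ i ≡ 0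
𝟙-outʳ {a} {b} {i} b≤ with 𝟙-cases a b i
... | inj₁ eq         = eq
... | inj₂ (_ , <b)   = contradiction <b (≤⇒≯ b≤)

𝟙-mono : ∀ {a a′ b b′} i → a′ ≤ a → b ≤ b′ → 𝟙[ a , b ⟩ i ≤ 𝟙[ a′ , b′ ⟩ i
𝟙-mono {a} {a′} {b} {b′} i a′≤a b≤b′ with 𝟙-cases a b i
... | inj₁ eq         = ≤-trans (≤-reflexive eq) z≤n
... | inj₂ (a≤ , <b)  =
  ≤-trans (𝟙≤1 a b i) (≤-reflexive (sym (𝟙-in (≤-trans a′≤a a≤) (<-≤-trans <b b≤b′))))

𝟙-split : ∀ {a b c} i → a ≤ b → b ≤ c → 𝟙[ a , b ⟩ i + 𝟙[ b , c ⟩ i ≤ 𝟙[ a , c ⟩ i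
𝟙-split {a} {b} {c} i a≤b b≤c with <-≤-connex (suc i) b
... | inj₁ <b rewrite 𝟙-outˡ {b} {c} {i} <b | +-identityʳ (𝟙[ a , b ⟩ i) = 𝟙-mono i ≤-refl b≤c
... | inj₂ b≤ rewrite 𝟙-outʳ {a} {b} {i} b≤ = 𝟙-mono i a≤b ≤-refl

shift : ℕ → (ℕ → ℕ) → ℕ → ℕ
shift zero    w i       = w i
shift (suc k) w zero    = 0
shift (suc k) w (suc i) = shift k w i

shift-< : ∀ {k i} w → i < k → shift k w i ≡ 0
shift-< {suc k} {zero}  w _         = refl
shift-< {suc k} {suc i} w (s<s i<k) = shift-< w i<k

shift-+ : ∀ k w j → shift k w (k + j) ≡ w j
shift-+ zero    w j = refl
shift-+ (suc k) w j = shift-+ k w j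

n/2≡⌊n/2⌋ : ∀ n → n / 2 ≡ ⌊ n /2⌋
n/2≡⌊n/2⌋ 0             = refl
n/2≡⌊n/2⌋ 1             = refl
n/2≡⌊n/2⌋ (suc (suc n)) =
  trans (m/n≡1+[m∸n]/n {suc (suc n)} {2} (s≤s (s≤s z≤n))) (cong suc (n/2≡⌊n/2⌋ n))

⌊m+[m+n]/2⌋≡m+⌊n/2⌋ : ∀ m n → ⌊ m + (m + n) /2⌋ ≡ m + ⌊ n /2⌋
⌊m+[m+n]/2⌋≡m+⌊n/2⌋ zero    n = refl
⌊m+[m+n]/2⌋≡m+⌊n/2⌋ (suc m) n rewrite +-suc m (m + n) = cong suc (⌊m+[m+n]/2⌋≡m+⌊n/2⌋ m n)

2*⌈n/2⌉≤1+n : ∀ n → 2 * ⌈ n /2⌉ ≤ suc n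
2*⌈n/2⌉≤1+n 0             = z≤n
2*⌈n/2⌉≤1+n 1             = ≤-refl
2*⌈n/2⌉≤1+n (suc (suc n)) rewrite *-suc 2 ⌈ n /2⌉ = s≤s (s≤s (2*⌈n/2⌉≤1+n n))

n≤1+2*⌊n/2⌋ : ∀ n → n ≤ suc (2 * ⌊ n /2⌋)
n≤1+2*⌊n/2⌋ 0             = z≤n
n≤1+2*⌊n/2⌋ 1             = ≤-refl
n≤1+2*⌊n/2⌋ (suc (suc n)) rewrite *-suc 2 ⌊ n /2⌋ = s≤s (s≤s (n≤1+2*⌊n/2⌋ n))

≤ᵇ≡false⇒2≤ : ∀ {m} → (m ≤ᵇ 1) ≡ false → 2 ≤ m
≤ᵇ≡false⇒2≤ {suc (suc m)} _ = s≤s (s≤s z≤n)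

record Midpoint (lo hi mid : ℕ) : Set where
  field
    lo<mid : lo < mid
    mid<hi : mid < hi
    left   : 2 * (mid ∸ lo) ≤ suc (hi ∸ lo)
    right  : 2 * (hi ∸ mid) ≤ suc (hi ∸ lo)

midpoint-offset : ∀ lo d h → 0 < h → h < d → 2 * h ≤ suc d → 2 * (d ∸ h) ≤ suc d →
                  Midpoint lo (lo + d) (lo + h)
midpoint-offset lo d h 0<h h<d left right = record
  { lo<mid = m<m+n lo 0<h
  ; mid<hi = +-monoʳ-< lo h<d
  ; left   = subst₂ (λ x y → 2 * x ≤ suc y) (sym (m+n∸m≡n lo h)) (sym (m+n∸m≡n lo d)) left
  ; right  = subst₂ (λ x y → 2 * x ≤ suc y) (sym ([m+n]∸[m+o]≡n∸o lo d h)) (sym (m+n∸m≡n lo d)) right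
  }

midpoint : ∀ lo hi → 2 ≤ hi ∸ lo → Midpoint lo hi ((lo + hi) / 2)
midpoint lo hi 2≤d = subst (λ h → Midpoint lo h ((lo + h) / 2)) (m+[n∸m]≡n lo≤hi) (halve (hi ∸ lo) 2≤d)
  where
  lo≤hi : lo ≤ hi
  lo≤hi = <⇒≤ (m∸n≢0⇒n<m λ d≡0 → contradiction (subst (2 ≤_) d≡0 2≤d) λ ())

  ⌊d/2⌋<d : ∀ {d} → 1 ≤ d → ⌊ d /2⌋ < d
  ⌊d/2⌋<d {suc d} _ = ⌊n/2⌋<n d

  d∸⌊d/2⌋≡⌈d/2⌉ : ∀ d → d ∸ ⌊ d /2⌋ ≡ ⌈ d /2⌉
  d∸⌊d/2⌋≡⌈d/2⌉ d =
    trans (cong (_∸ ⌊ d /2⌋) (sym (⌊n/2⌋+⌈n/2⌉≡n d))) (m+n∸m≡n ⌊ d /2⌋ ⌈ d /2⌉)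

  halve : ∀ d → 2 ≤ d → Midpoint lo (lo + d) ((lo + (lo + d)) / 2)
  halve d 2≤d = subst (Midpoint lo (lo + d)) (sym mid≡) (midpoint-offset lo d ⌊ d /2⌋
    (⌊n/2⌋-mono 2≤d)
    (⌊d/2⌋<d (≤-trans (s≤s z≤n) 2≤d))
    (≤-trans (*-monoʳ-≤ 2 (⌊n/2⌋≤⌈n/2⌉ d)) (2*⌈n/2⌉≤1+n d))
    (subst (λ x → 2 * x ≤ suc d) (sym (d∸⌊d/2⌋≡⌈d/2⌉ d)) (2*⌈n/2⌉≤1+n d)))
    where
    mid≡ : (lo + (lo + d)) / 2 ≡ lo + ⌊ d /2⌋
    mid≡ = trans (n/2≡⌊n/2⌋ (lo + (lo + d))) (⌊m+[m+n]/2⌋≡m+⌊n/2⌋ lo d)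

2^≤⇒≤⌊log₂⌋ : ∀ {k m} → 2 ^ k ≤ m → k ≤ ⌊log₂ m ⌋
2^≤⇒≤⌊log₂⌋ {k} {m} h = subst (_≤ ⌊log₂ m ⌋) (⌊log₂[2^n]⌋≡n k) (⌊log₂⌋-mono-≤ h)

-- An interval of d positions admits a binary search with k comparisons only if d > 2 ^ (k - 1).
Fits : ℕ → ℕ → Set
Fits zero    d = ⊤
Fits (suc k) d = 2 ^ k < d

fits-mono : ∀ k {d d′} → Fits k d → d ≤ d′ → Fits k d′
fits-mono zero    _   _    = _
fits-mono (suc k) fit d≤d′ = <-≤-trans fit d≤d′

fits-halve : ∀ k {d d′} → Fits k d′ → 2 * d′ ≤ suc d → 2 ≤ d → Fits (suc k) d
fits-halve zero    _   _         2≤d = 2≤d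
fits-halve (suc k) fit 2d′≤1+d _ =
  s≤s⁻¹ (≤-trans (≤-reflexive (sym (*-suc 2 (2 ^ k)))) (≤-trans (*-monoʳ-≤ 2 fit) 2d′≤1+d))

fits⇒≤1+⌊log₂⌋ : ∀ k {d} → Fits k d → k ≤ suc ⌊log₂ d ⌋
fits⇒≤1+⌊log₂⌋ zero    _   = z≤n
fits⇒≤1+⌊log₂⌋ (suc k) fit = s≤s (2^≤⇒≤⌊log₂⌋ (<⇒≤ fit))

searchCost : ℕ → ℕ
searchCost m = suc ⌊log₂ (2 * m) ⌋ + suc ⌊log₂ (2 * m) ⌋

searchCost-mono : ∀ {m n} → m ≤ n → searchCost m ≤ searchCost n
searchCost-mono m≤n = +-mono-≤ half half
  where half = s≤s (⌊log₂⌋-mono-≤ (*-monoʳ-≤ 2 m≤n))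

probed : ℕ → ℕ → ℕ
probed ℓ i = 𝟙[ 1 , 2 + 2 * ℓ ⟩ i + 𝟙[ 1 , 2 + 2 * ℓ ⟩ i

probed≤2 : ∀ ℓ i → probed ℓ i ≤ 2
probed≤2 ℓ i = +-mono-≤ (𝟙≤1 1 (2 + 2 * ℓ) i) (𝟙≤1 1 (2 + 2 * ℓ) i)

probed-beyond : ∀ {ℓ i} → 2 + 2 * ℓ ≤ suc i → probed ℓ i ≡ 0
probed-beyond {ℓ} {i} beyond rewrite 𝟙-outʳ {1} {2 + 2 * ℓ} {i} beyond = refl

-- The potential of l at position i (from 0) of the sequence searched in (Φᴮ) and of the sequence
-- whose head is searched next (Φᴬ); L bounds the cost of one exponential search.
module _ (L : ℕ) where

  Φᴮ : ℕ → ℕ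
  Φᴮ i = 2 * suc ⌊log₂ (suc i) ⌋ + L

  Φᴬ : ℕ → ℕ
  Φᴬ zero    = L
  Φᴬ (suc i) = Φᴮ i

  Φᴮ-mono : ∀ {i j} → i ≤ j → Φᴮ i ≤ Φᴮ j
  Φᴮ-mono i≤j = +-monoˡ-≤ L (*-monoʳ-≤ 2 (s≤s (⌊log₂⌋-mono-≤ (s≤s i≤j))))

  2+L≤Φᴮ : ∀ i → 2 + L ≤ Φᴮ i
  2+L≤Φᴮ i = +-monoˡ-≤ L (*-monoʳ-≤ 2 (s≤s z≤n))

  Φᴮ-bound : ∀ {p n} → p < n → Φᴮ p ≤ 2 * suc ⌊log₂ n ⌋ + L
  Φᴮ-bound p<n = +-monoˡ-≤ L (*-monoʳ-≤ 2 (s≤s (⌊log₂⌋-mono-≤ p<n)))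

  Φᴬ≤Φᴮ : ∀ i → Φᴬ i ≤ Φᴮ i
  Φᴬ≤Φᴮ zero    = ≤-trans (n≤1+n L) (≤-trans (n≤1+n (suc L)) (2+L≤Φᴮ 0))
  Φᴬ≤Φᴮ (suc i) = Φᴮ-mono (n≤1+n i)

  -- If l is probed, its 1-based position ℓ + j + 1 is at most 2ℓ + 1, so j ≤ ℓ and the position is
  -- at least 2j: the logarithm drops by one from Φᴮ (ℓ + j) to Φᴬ j, paying for the two probes.
  probed+Φᴬ≤Φᴮ : ∀ ℓ j → probed ℓ (ℓ + j) + Φᴬ j ≤ Φᴮ (ℓ + j)
  probed+Φᴬ≤Φᴮ ℓ zero = ≤-trans (+-monoˡ-≤ L (probed≤2 ℓ (ℓ + 0))) (2+L≤Φᴮ (ℓ + 0))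
  probed+Φᴬ≤Φᴮ ℓ (suc j) with <-≤-connex ℓ (suc j)
  ... | inj₂ 1+j≤ℓ = begin
    probed ℓ (ℓ + suc j) + Φᴮ j          ≤⟨ +-monoˡ-≤ (Φᴮ j) (probed≤2 ℓ (ℓ + suc j)) ⟩
    2 + 2 * suc x + L                    ≡⟨ cong (_+ L) (sym (*-suc 2 (suc x))) ⟩
    2 * suc (suc x) + L                  ≡⟨ cong (λ y → 2 * suc y + L) (sym (⌊log₂[2*b]⌋≡1+⌊log₂b⌋ (suc j))) ⟩
    2 * suc ⌊log₂ (2 * suc j) ⌋ + L      ≤⟨ +-monoˡ-≤ L (*-monoʳ-≤ 2 (s≤s (⌊log₂⌋-mono-≤ doubled))) ⟩
    Φᴮ (ℓ + suc j)                       ∎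
    where
    x = ⌊log₂ (suc j) ⌋
    doubled : 2 * suc j ≤ suc (ℓ + suc j)
    doubled = m≤n⇒m≤1+n (subst (_≤ ℓ + suc j) (cong (suc j +_) (sym (+-identityʳ (suc j))))
                                             (+-monoˡ-≤ (suc j) 1+j≤ℓ))
  ... | inj₁ ℓ<1+j = begin
    probed ℓ (ℓ + suc j) + Φᴮ j          ≡⟨ cong (_+ Φᴮ j) (probed-beyond {ℓ} {ℓ + suc j} beyond) ⟩
    Φᴮ j                                 ≤⟨ Φᴮ-mono (≤-trans (n≤1+n j) (m≤n+m (suc j) ℓ)) ⟩
    Φᴮ (ℓ + suc j)                       ∎
    where
    beyond : 2 + 2 * ℓ ≤ suc (ℓ + suc j)
    beyond = s≤s (subst (suc (2 * ℓ) ≤_) (sym (+-suc ℓ j))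
                        (s≤s (+-monoʳ-≤ ℓ (subst (_≤ j) (sym (+-identityʳ ℓ)) (s≤s⁻¹ ℓ<1+j)))))

  probed+shift≤Φᴮ : ∀ ℓ i → probed ℓ i + shift ℓ Φᴬ i ≤ Φᴮ i
  probed+shift≤Φᴮ ℓ i with <-≤-connex i ℓ
  ... | inj₁ i<ℓ rewrite shift-< Φᴬ i<ℓ | +-identityʳ (probed ℓ i) =
    ≤-trans (probed≤2 ℓ i) (≤-trans (m≤m+n 2 L) (2+L≤Φᴮ i))
  ... | inj₂ ℓ≤i rewrite sym (m+[n∸m]≡n ℓ≤i) | shift-+ ℓ Φᴬ (i ∸ ℓ) = probed+Φᴬ≤Φᴮ ℓ (i ∸ ℓ)

module _ (O : StrictTotalOrder 0ℓ 0ℓ 0ℓ) where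
  open Merge O

  at-bounds : ∀ bs m {b} → at bs m ≡ just b → 1 ≤ m × m ≤ length bs
  at-bounds (_ ∷ _)  (suc zero)    _  = s≤s z≤n , s≤s z≤n
  at-bounds (_ ∷ bs) (suc (suc i)) eq = s≤s z≤n , s≤s (proj₂ (at-bounds bs (suc i) eq))

  doubling-≥ : ∀ f e bs p {q cs} → doubling f e bs p ≡ (q , cs) → p ≤ q
  doubling-≥ zero    e bs p refl = ≤-refl
  doubling-≥ (suc f) e bs p eq with at bs p
  doubling-≥ (suc f) e bs p refl | nothing = ≤-refl
  ... | just b with lt? (proj₂ e) (proj₂ b)
  doubling-≥ (suc f) e bs p refl | just b | true = ≤-refl
  ... | false with doubling f e bs (p + p) in dbl≡
  doubling-≥ (suc f) e bs p refl | just b | false | _ = ≤-trans (m≤m+n p p) (doubling-≥ f e bs (p + p) dbl≡)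

  doubling-≤ : ∀ f e bs p {q cs} → doubling f e bs p ≡ (q , cs) → q ≤ p ⊔ 2 * length bs
  doubling-≤ zero    e bs p refl = m≤m⊔n p _
  doubling-≤ (suc f) e bs p eq with at bs p in at≡
  doubling-≤ (suc f) e bs p refl | nothing = m≤m⊔n p _
  ... | just b with lt? (proj₂ e) (proj₂ b)
  doubling-≤ (suc f) e bs p refl | just b | true = m≤m⊔n p _
  ... | false with doubling f e bs (p + p) in dbl≡
  doubling-≤ (suc f) e bs p refl | just b | false | _ =
    ≤-trans (doubling-≤ f e bs (p + p) dbl≡) (≤-trans (≤-reflexive (m≤n⇒m⊔n≡n 2p≤2m)) (m≤n⊔m p _))
    where
    2p≤2m : p + p ≤ 2 * length bs
    2p≤2m = ≤-trans (≤-reflexive (cong (p +_) (sym (+-identityʳ p))))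
                    (*-monoʳ-≤ 2 (proj₂ (at-bounds bs p at≡)))

  doubling-last : ∀ f e bs p {q c cs} → doubling f e bs p ≡ (q , c ∷ cs) → p * 2 ^ length cs ≤ length bs
  doubling-last zero    e bs p ()
  doubling-last (suc f) e bs p eq with at bs p in at≡
  doubling-last (suc f) e bs p () | nothing
  ... | just b with lt? (proj₂ e) (proj₂ b)
  doubling-last (suc f) e bs p refl | just b | true =
    subst (_≤ length bs) (sym (*-identityʳ p)) (proj₂ (at-bounds bs p at≡))
  ... | false with doubling f e bs (p + p) in dbl≡
  doubling-last (suc f) e bs p refl | just b | false | (_ , []) =
    subst (_≤ length bs) (sym (*-identityʳ p)) (proj₂ (at-bounds bs p at≡))
  doubling-last (suc f) e bs p refl | just b | false | (_ , _ ∷ cs) =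
    subst (_≤ length bs) (sym (p*[2*x]≡[p+p]*x p (2 ^ length cs))) (doubling-last f e bs (p + p) dbl≡)
    where
    p*[2*x]≡[p+p]*x : ∀ p x → p * (2 * x) ≡ (p + p) * x
    p*[2*x]≡[p+p]*x = solve-∀

  doubling-length : ∀ e bs {q cs} → doubling (suc (length bs)) e bs 1 ≡ (q , cs) →
                    length cs ≤ suc ⌊log₂ (length bs) ⌋
  doubling-length e bs {cs = []}    _    = z≤n
  doubling-length e bs {cs = _ ∷ _} dbl≡ =
    s≤s (2^≤⇒≤⌊log₂⌋ (subst (_≤ length bs) (*-identityˡ _) (doubling-last _ e bs 1 dbl≡)))

  binary-≥ : ∀ f e bs lo hi {r cs} → binary f e bs lo hi ≡ (r , cs) → lo ≤ r
  binary-≥ zero    e bs lo hi refl = ≤-refl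
  binary-≥ (suc f) e bs lo hi eq with (hi ∸ lo) ≤ᵇ 1 in short
  binary-≥ (suc f) e bs lo hi refl | true = ≤-refl
  ... | false with at bs ((lo + hi) / 2)
  ... | nothing = binary-≥ f e bs lo _ eq
  ... | just b with lt? (proj₂ e) (proj₂ b)
  ... | true with binary f e bs lo ((lo + hi) / 2) in bin≡
  binary-≥ (suc f) e bs lo hi refl | false | just b | true | _ = binary-≥ f e bs lo _ bin≡
  binary-≥ (suc f) e bs lo hi eq | false | just b | false with binary f e bs ((lo + hi) / 2) hi in bin≡
  binary-≥ (suc f) e bs lo hi refl | false | just b | false | _ =
    ≤-trans (<⇒≤ (Midpoint.lo<mid (midpoint lo hi (≤ᵇ≡false⇒2≤ short)))) (binary-≥ f e bs _ hi bin≡)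

  binary-fits : ∀ f e bs lo hi {r cs} → binary f e bs lo hi ≡ (r , cs) → Fits (length cs) (hi ∸ lo)
  binary-fits zero    e bs lo hi refl = _
  binary-fits (suc f) e bs lo hi eq with (hi ∸ lo) ≤ᵇ 1 in short
  binary-fits (suc f) e bs lo hi refl | true = _
  ... | false with at bs ((lo + hi) / 2)
  ... | nothing = fits-mono _ (binary-fits f e bs lo _ eq) (∸-monoˡ-≤ lo (<⇒≤ (Midpoint.mid<hi M)))
    where M = midpoint lo hi (≤ᵇ≡false⇒2≤ short)
  ... | just b with lt? (proj₂ e) (proj₂ b)
  ... | true with binary f e bs lo ((lo + hi) / 2) in bin≡
  binary-fits (suc f) e bs lo hi refl | false | just b | true | (_ , cs) =
    fits-halve (length cs) (binary-fits f e bs lo _ bin≡) (Midpoint.left M) (≤ᵇ≡false⇒2≤ short)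
    where M = midpoint lo hi (≤ᵇ≡false⇒2≤ short)
  binary-fits (suc f) e bs lo hi eq | false | just b | false with binary f e bs ((lo + hi) / 2) hi in bin≡
  binary-fits (suc f) e bs lo hi refl | false | just b | false | (_ , cs) =
    fits-halve (length cs) (binary-fits f e bs _ hi bin≡) (Midpoint.right M) (≤ᵇ≡false⇒2≤ short)
    where M = midpoint lo hi (≤ᵇ≡false⇒2≤ short)

  -- When the doubling phase stops at q = 1 no binary search is run, which is exactly what the
  -- binary search on (0, 1) does; so every run is a doubling phase followed by a binary search.
  record ExpSearchRun (e : E) (bs : List E) (ℓ : ℕ) (cs : List Cmp) : Set where
    constructor run
    field
      q                 : ℕ
      doubled bisected  : List Cmp
      doubling≡         : doubling (suc (length bs)) e bs 1 ≡ (q , doubled)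
      binary≡           : binary q e bs (q / 2) q ≡ (ℓ , bisected)
      cs≡               : cs ≡ doubled ++ bisected

  expSearch-run : ∀ e bs {ℓ cs} → expSearch e bs ≡ (ℓ , cs) → ExpSearchRun e bs ℓ cs
  expSearch-run e bs eq with doubling (suc (length bs)) e bs 1 in dbl≡
  expSearch-run e bs refl | (zero , cs)     = run 0 cs [] dbl≡ refl refl
  expSearch-run e bs refl | (suc zero , cs) = run 1 cs [] dbl≡ refl (sym (++-identityʳ cs))
  expSearch-run e bs eq   | (suc (suc k) , cs) with binary (suc (suc k)) e bs (suc (suc k) / 2) (suc (suc k)) in bin≡
  expSearch-run e bs refl | (suc (suc k) , cs) | (_ , cs′) = run (suc (suc k)) cs cs′ dbl≡ bin≡ refl

  search-length : ∀ e b bs {ℓ cs} → expSearch e (b ∷ bs) ≡ (ℓ , cs) →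
                  length cs ≤ searchCost (length (b ∷ bs))
  search-length e b bs eq with expSearch-run e (b ∷ bs) eq
  ... | run q doubled bisected dbl≡ bin≡ refl rewrite length-++ doubled {bisected} = +-mono-≤
    (≤-trans (doubling-length e (b ∷ bs) dbl≡) (s≤s (⌊log₂⌋-mono-≤ (m≤n*m m 2))))
    (≤-trans (fits⇒≤1+⌊log₂⌋ _ (binary-fits q e (b ∷ bs) _ q bin≡)) (s≤s (⌊log₂⌋-mono-≤ q∸q/2≤2m)))
    where
    m = length (b ∷ bs)
    q∸q/2≤2m : q ∸ q / 2 ≤ 2 * m
    q∸q/2≤2m = ≤-trans (m∸n≤m q (q / 2))
      (≤-trans (doubling-≤ _ e (b ∷ bs) 1 dbl≡) (≤-reflexive (m≤n⇒m⊔n≡n (s≤s z≤n))))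

  label-length : ∀ t i xs → length (label t i xs) ≡ length xs
  label-length t i []       = refl
  label-length t i (x ∷ xs) = cong suc (label-length t (suc i) xs)

  module _ (l : Label) where

    δ : Label → ℕ
    δ x = if does (l ≟L x) then 1 else 0

    weight : (ℕ → ℕ) → List E → ℕ
    weight w []       = 0
    weight w (y ∷ ys) = (if does (l ≟L proj₁ y) then w 0 else 0) + weight (w ∘ suc) ys

    weight-mono : ∀ {w w′} → (∀ i → w i ≤ w′ i) → ∀ ys → weight w ys ≤ weight w′ ys
    weight-mono w≤w′ []       = z≤n
    weight-mono w≤w′ (y ∷ ys) with does (l ≟L proj₁ y)
    ... | true  = +-mono-≤ (w≤w′ 0) (weight-mono (w≤w′ ∘ suc) ys)
    ... | false = weight-mono (w≤w′ ∘ suc) ys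

    weight-+ : ∀ w w′ ys → weight w ys + weight w′ ys ≡ weight (λ i → w i + w′ i) ys
    weight-+ w w′ []       = refl
    weight-+ w w′ (y ∷ ys) with does (l ≟L proj₁ y)
    ... | true  = trans (interchange (w 0) _ (w′ 0) _)
                        (cong (w 0 + w′ 0 +_) (weight-+ (w ∘ suc) (w′ ∘ suc) ys))
    ... | false = weight-+ (w ∘ suc) (w′ ∘ suc) ys

    weight-drop : ∀ k w ys → weight w (drop k ys) ≡ weight (shift k w) ys
    weight-drop zero    w ys       = refl
    weight-drop (suc k) w []       = refl
    weight-drop (suc k) w (y ∷ ys) with does (l ≟L proj₁ y)
    ... | true  = weight-drop k w ys
    ... | false = weight-drop k w ys

    weight-𝟙-mono : ∀ {a a′ b b′} → a′ ≤ a → b ≤ b′ → ∀ ys →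
                    weight 𝟙[ a , b ⟩ ys ≤ weight 𝟙[ a′ , b′ ⟩ ys
    weight-𝟙-mono a′≤a b≤b′ = weight-mono (λ i → 𝟙-mono i a′≤a b≤b′)

    weight-𝟙-split : ∀ {a b c} → a ≤ b → b ≤ c → ∀ ys →
                     weight 𝟙[ a , b ⟩ ys + weight 𝟙[ b , c ⟩ ys ≤ weight 𝟙[ a , c ⟩ ys
    weight-𝟙-split a≤b b≤c ys =
      ≤-trans (≤-reflexive (weight-+ _ _ ys)) (weight-mono (λ i → 𝟙-split i a≤b b≤c) ys)

    weight-probe : ∀ bs m {b} → at bs m ≡ just b → δ (proj₁ b) ≤ weight 𝟙[ m , suc m ⟩ bs
    weight-probe []      zero    ()
    weight-probe (_ ∷ _) zero    ()
    weight-probe bs      (suc i) at≡ = weight-at bs i _ at≡ (≤-reflexive (sym (𝟙-in ≤-refl ≤-refl)))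
      where
      weight-at : ∀ bs i w {b} → at bs (suc i) ≡ just b → 1 ≤ w i → δ (proj₁ b) ≤ weight w bs
      weight-at (x ∷ bs) zero    w refl 1≤w with does (l ≟L proj₁ x)
      ... | true  = ≤-trans 1≤w (m≤m+n _ _)
      ... | false = z≤n
      weight-at (x ∷ bs) (suc i) w at≡ 1≤w = ≤-trans (weight-at bs i (w ∘ suc) at≡ 1≤w) (m≤n+m _ _)

    participations-++ : ∀ cs cs′ → participations l (cs ++ cs′) ≡ participations l cs + participations l cs′
    participations-++ []             cs′ = refl
    participations-++ ((x , y) ∷ cs) cs′ =
      trans (cong (hit +_) (participations-++ cs cs′)) (sym (+-assoc hit (participations l cs) _))
      where hit = if does (l ≟L x) ∨ does (l ≟L y) then 1 else 0

    participations≤length : ∀ cs → participations l cs ≤ length cs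
    participations≤length []             = z≤n
    participations≤length ((x , y) ∷ cs) with does (l ≟L x) | does (l ≟L y)
    ... | true  | _     = s≤s (participations≤length cs)
    ... | false | true  = s≤s (participations≤length cs)
    ... | false | false = m≤n⇒m≤1+n (participations≤length cs)

    participations-∷ : ∀ {x} y cs → ¬ l ≡ x →
                       participations l ((x , y) ∷ cs) ≡ δ y + participations l cs
    participations-∷ {x} y cs l≢x with l ≟L x
    ... | yes l≡x = contradiction l≡x l≢x
    ... | no _    = refl

    doubling-probes : ∀ f e bs p {q cs} → ¬ l ≡ proj₁ e → doubling f e bs p ≡ (q , cs) →
                      participations l cs ≤ weight 𝟙[ p , suc q ⟩ bs
    doubling-probes zero    e bs p l≢e refl = z≤n
    doubling-probes (suc f) e bs p l≢e eq with at bs p in at≡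
    doubling-probes (suc f) e bs p l≢e refl | nothing = z≤n
    ... | just b with lt? (proj₂ e) (proj₂ b)
    doubling-probes (suc f) e bs p l≢e refl | just b | true = begin
      participations l ((proj₁ e , proj₁ b) ∷ [])  ≡⟨ participations-∷ (proj₁ b) [] l≢e ⟩
      δ (proj₁ b) + 0                             ≡⟨ +-identityʳ _ ⟩
      δ (proj₁ b)                                 ≤⟨ weight-probe bs p at≡ ⟩
      weight 𝟙[ p , suc p ⟩ bs                    ∎
    ... | false with doubling f e bs (p + p) in dbl≡
    doubling-probes (suc f) e bs p l≢e refl | just b | false | (q , cs) = begin
      participations l ((proj₁ e , proj₁ b) ∷ cs)
        ≡⟨ participations-∷ (proj₁ b) cs l≢e ⟩
      δ (proj₁ b) + participations l cs
        ≤⟨ +-mono-≤ (weight-probe bs p at≡) (doubling-probes f e bs (p + p) l≢e dbl≡) ⟩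
      weight 𝟙[ p , suc p ⟩ bs + weight 𝟙[ p + p , suc q ⟩ bs
        ≤⟨ +-monoʳ-≤ _ (weight-𝟙-mono (+-monoˡ-≤ p (proj₁ (at-bounds bs p at≡))) ≤-refl bs) ⟩
      weight 𝟙[ p , suc p ⟩ bs + weight 𝟙[ suc p , suc q ⟩ bs
        ≤⟨ weight-𝟙-split (n≤1+n p) (s≤s (≤-trans (m≤m+n p p) (doubling-≥ f e bs (p + p) dbl≡))) bs ⟩
      weight 𝟙[ p , suc q ⟩ bs
        ∎

    binary-probes : ∀ f e bs lo hi {r cs} → ¬ l ≡ proj₁ e → binary f e bs lo hi ≡ (r , cs) →
                    participations l cs ≤ weight 𝟙[ suc lo , hi ⟩ bs
    binary-probes zero    e bs lo hi l≢e refl = z≤n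
    binary-probes (suc f) e bs lo hi l≢e eq with (hi ∸ lo) ≤ᵇ 1 in short
    binary-probes (suc f) e bs lo hi l≢e refl | true = z≤n
    ... | false with at bs ((lo + hi) / 2) in at≡
    ... | nothing =
      ≤-trans (binary-probes f e bs lo _ l≢e eq) (weight-𝟙-mono ≤-refl (<⇒≤ (Midpoint.mid<hi M)) bs)
      where M = midpoint lo hi (≤ᵇ≡false⇒2≤ short)
    ... | just b with lt? (proj₂ e) (proj₂ b)
    ... | true with binary f e bs lo ((lo + hi) / 2) in bin≡
    binary-probes (suc f) e bs lo hi l≢e refl | false | just b | true | (_ , cs) = begin
      participations l ((proj₁ e , proj₁ b) ∷ cs)
        ≡⟨ participations-∷ (proj₁ b) cs l≢e ⟩
      δ (proj₁ b) + participations l cs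
        ≤⟨ +-mono-≤ (weight-probe bs mid at≡) (binary-probes f e bs lo mid l≢e bin≡) ⟩
      weight 𝟙[ mid , suc mid ⟩ bs + weight 𝟙[ suc lo , mid ⟩ bs
        ≡⟨ +-comm (weight 𝟙[ mid , suc mid ⟩ bs) _ ⟩
      weight 𝟙[ suc lo , mid ⟩ bs + weight 𝟙[ mid , suc mid ⟩ bs
        ≤⟨ weight-𝟙-split (Midpoint.lo<mid M) (n≤1+n mid) bs ⟩
      weight 𝟙[ suc lo , suc mid ⟩ bs
        ≤⟨ weight-𝟙-mono ≤-refl (Midpoint.mid<hi M) bs ⟩
      weight 𝟙[ suc lo , hi ⟩ bs
        ∎
      where
      mid = (lo + hi) / 2
      M = midpoint lo hi (≤ᵇ≡false⇒2≤ short)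
    binary-probes (suc f) e bs lo hi l≢e eq | false | just b | false with binary f e bs ((lo + hi) / 2) hi in bin≡
    binary-probes (suc f) e bs lo hi l≢e refl | false | just b | false | (_ , cs) = begin
      participations l ((proj₁ e , proj₁ b) ∷ cs)
        ≡⟨ participations-∷ (proj₁ b) cs l≢e ⟩
      δ (proj₁ b) + participations l cs
        ≤⟨ +-mono-≤ (weight-probe bs mid at≡) (binary-probes f e bs mid hi l≢e bin≡) ⟩
      weight 𝟙[ mid , suc mid ⟩ bs + weight 𝟙[ suc mid , hi ⟩ bs
        ≤⟨ weight-𝟙-split (n≤1+n mid) (Midpoint.mid<hi M) bs ⟩
      weight 𝟙[ mid , hi ⟩ bs
        ≤⟨ weight-𝟙-mono (Midpoint.lo<mid M) ≤-refl bs ⟩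
      weight 𝟙[ suc lo , hi ⟩ bs
        ∎
      where
      mid = (lo + hi) / 2
      M = midpoint lo hi (≤ᵇ≡false⇒2≤ short)

    search-probes : ∀ e bs {ℓ cs} → ¬ l ≡ proj₁ e → expSearch e bs ≡ (ℓ , cs) →
                    participations l cs ≤ weight (probed ℓ) bs
    search-probes e bs {ℓ} l≢e eq with expSearch-run e bs eq
    ... | run q doubled bisected dbl≡ bin≡ refl = begin
      participations l (doubled ++ bisected)
        ≡⟨ participations-++ doubled bisected ⟩
      participations l doubled + participations l bisected
        ≤⟨ +-mono-≤ (doubling-probes _ e bs 1 l≢e dbl≡) (binary-probes q e bs _ q l≢e bin≡) ⟩
      weight 𝟙[ 1 , suc q ⟩ bs + weight 𝟙[ suc (q / 2) , q ⟩ bs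
        ≤⟨ +-mono-≤ (weight-𝟙-mono ≤-refl (s≤s q≤1+2ℓ) bs)
                    (weight-𝟙-mono (s≤s z≤n) (m≤n⇒m≤1+n q≤1+2ℓ) bs) ⟩
      weight 𝟙[ 1 , 2 + 2 * ℓ ⟩ bs + weight 𝟙[ 1 , 2 + 2 * ℓ ⟩ bs
        ≡⟨ weight-+ _ _ bs ⟩
      weight (probed ℓ) bs
        ∎
      where
      q≤1+2ℓ : q ≤ suc (2 * ℓ)
      q≤1+2ℓ = ≤-trans (n≤1+2*⌊n/2⌋ q)
        (s≤s (*-monoʳ-≤ 2 (subst (_≤ ℓ) (n/2≡⌊n/2⌋ q) (binary-≥ q e bs _ q bin≡))))

    module _ (N : ℕ) where

      L : ℕ
      L = searchCost N

      search-charge : ∀ a b bs {ℓ cs} → length (b ∷ bs) ≤ N → expSearch a (b ∷ bs) ≡ (ℓ , cs) →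
                      participations l cs ≤
                        (if does (l ≟L proj₁ a) then L else 0) + weight (probed ℓ) (b ∷ bs)
      search-charge a b bs {cs = cs} m≤N eq with l ≟L proj₁ a
      ... | yes _   = ≤-trans (participations≤length cs)
                        (≤-trans (search-length a b bs eq) (≤-trans (searchCost-mono m≤N) (m≤m+n L _)))
      ... | no l≢a  = search-probes a (b ∷ bs) l≢a eq

      participations≤potential : ∀ f X Y → length X ≤ N → length Y ≤ N →
                    participations l (proj₂ (expMerge′ f X Y)) ≤ weight (Φᴬ L) X + weight (Φᴮ L) Y
      participations≤potential f       []       Y        _ _ = z≤n
      participations≤potential f       (a ∷ as) []       _ _ = z≤n
      participations≤potential zero    (a ∷ as) (b ∷ bs) _ _ = z≤n
      participations≤potential (suc f) (a ∷ as) (b ∷ bs) |X|≤N |Y|≤N with expSearch a (b ∷ bs) in search≡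
      ... | (ℓ , cs) with expMerge′ f (drop ℓ (b ∷ bs)) as in merge≡
      ... | (_ , cs′) = begin
        participations l (cs ++ cs′)
          ≡⟨ participations-++ cs cs′ ⟩
        participations l cs + participations l cs′
          ≤⟨ +-mono-≤ (search-charge a b bs |Y|≤N search≡) rest ⟩
        (c + weight (probed ℓ) Y) + (weight (Φᴬ L) (drop ℓ Y) + weight (Φᴮ L) as)
          ≡⟨ cong (λ s → (c + weight (probed ℓ) Y) + (s + weight (Φᴮ L) as)) (weight-drop ℓ (Φᴬ L) Y) ⟩
        (c + weight (probed ℓ) Y) + (weight (shift ℓ (Φᴬ L)) Y + weight (Φᴮ L) as)
          ≡⟨ regroup c _ _ _ ⟩
        (c + weight (Φᴮ L) as) + (weight (probed ℓ) Y + weight (shift ℓ (Φᴬ L)) Y)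
          ≡⟨ cong (c + weight (Φᴮ L) as +_) (weight-+ (probed ℓ) (shift ℓ (Φᴬ L)) Y) ⟩
        (c + weight (Φᴮ L) as) + weight (λ i → probed ℓ i + shift ℓ (Φᴬ L) i) Y
          ≤⟨ +-monoʳ-≤ (c + weight (Φᴮ L) as) (weight-mono (probed+shift≤Φᴮ L ℓ) Y) ⟩
        weight (Φᴬ L) (a ∷ as) + weight (Φᴮ L) Y
          ∎
        where
        Y = b ∷ bs
        c = if does (l ≟L proj₁ a) then L else 0
        regroup : ∀ c p s b → (c + p) + (s + b) ≡ (c + b) + (p + s)
        regroup = solve-∀
        rest : participations l cs′ ≤ weight (Φᴬ L) (drop ℓ Y) + weight (Φᴮ L) as
        rest = subst (λ r → participations l (proj₂ r) ≤ weight (Φᴬ L) (drop ℓ Y) + weight (Φᴮ L) as) merge≡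
          (participations≤potential f (drop ℓ Y) as
            (≤-trans (≤-reflexive (length-drop ℓ Y)) (≤-trans (m∸n≤m (length Y) ℓ) |Y|≤N))
            (≤-trans (n≤1+n _) |X|≤N))

    weight-label-∉ : ∀ t i xs w → (∀ j → i ≤ j → l ≢ t j) → weight w (label t i xs) ≡ 0
    weight-label-∉ t i []       w l∉ = refl
    weight-label-∉ t i (x ∷ xs) w l∉ with l ≟L t i
    ... | yes l≡ti = contradiction l≡ti (l∉ i ≤-refl)
    ... | no _     = weight-label-∉ t (suc i) xs (w ∘ suc) (λ j i<j → l∉ j (<⇒≤ i<j))

    weight-label-≤ : ∀ t i xs w M → Injective _≡_ _≡_ t → (∀ p → p < length xs → w p ≤ M) →
                     weight w (label t i xs) ≤ M
    weight-label-≤ t i []       w M t-inj w≤M = z≤n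
    weight-label-≤ t i (x ∷ xs) w M t-inj w≤M with l ≟L t i
    ... | yes l≡ti rewrite weight-label-∉ t (suc i) xs (w ∘ suc) (λ j i<j l≡tj → <⇒≢ i<j (t-inj (trans (sym l≡ti) l≡tj)))
      = ≤-trans (≤-reflexive (+-identityʳ (w 0))) (w≤M 0 (s≤s z≤n))
    ... | no _ = weight-label-≤ t (suc i) xs (w ∘ suc) M t-inj (λ p p<n → w≤M (suc p) (s≤s p<n))

  initial-potential≤ : ∀ l L n A B → length A ≡ n → length B ≡ n →
                       weight l (Φᴬ L) (label inj₁ 0 A) + weight l (Φᴮ L) (label inj₂ 0 B) ≤
                         2 * suc ⌊log₂ n ⌋ + L
  initial-potential≤ l@(inj₁ _) L n A B |A|≡n _
    rewrite weight-label-∉ l inj₂ 0 B (Φᴮ L) (λ _ _ ()) | +-identityʳ (weight l (Φᴬ L) (label inj₁ 0 A)) =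
    weight-label-≤ l inj₁ 0 A (Φᴬ L) _ inj₁-injective
      (λ p p<|A| → ≤-trans (Φᴬ≤Φᴮ L p) (Φᴮ-bound L (subst (p <_) |A|≡n p<|A|)))
  initial-potential≤ l@(inj₂ _) L n A B _ |B|≡n
    rewrite weight-label-∉ l inj₁ 0 A (Φᴬ L) (λ _ _ ()) =
    weight-label-≤ l inj₂ 0 B (Φᴮ L) _ inj₂-injective
      (λ p p<|B| → Φᴮ-bound L (subst (p <_) |B|≡n p<|B|))

6+4x≤10x : ∀ x → 1 ≤ x → 2 * suc x + (suc (suc x) + suc (suc x)) ≤ 10 * x
6+4x≤10x x 1≤x = begin
  2 * suc x + (suc (suc x) + suc (suc x)) ≡⟨ lhs≡ x ⟩
  6 * 1 + 4 * x                           ≤⟨ +-monoˡ-≤ (4 * x) (*-monoʳ-≤ 6 1≤x) ⟩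
  6 * x + 4 * x                           ≡⟨ rhs≡ x ⟩
  10 * x                                  ∎
  where
  lhs≡ : ∀ x → 2 * suc x + (suc (suc x) + suc (suc x)) ≡ 6 * 1 + 4 * x
  lhs≡ = solve-∀
  rhs≡ : ∀ x → 6 * x + 4 * x ≡ 10 * x
  rhs≡ = solve-∀

comparisonsOf≤10*⌊log₂n⌋ : ∀ (O : StrictTotalOrder 0ℓ 0ℓ 0ℓ) n → 2 ≤ n →
                           ∀ A B → length A ≡ n → length B ≡ n → ∀ l → Merge.comparisonsOf O l A B ≤ 10 * ⌊log₂ n ⌋
comparisonsOf≤10*⌊log₂n⌋ O n 2≤n A B |A|≡n |B|≡n l = begin
  comparisonsOf l A B
    ≤⟨ participations≤potential O l n _ (label inj₁ 0 A) (label inj₂ 0 B)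
                                (|label|≤n inj₁ A |A|≡n) (|label|≤n inj₂ B |B|≡n) ⟩
  weight O l (Φᴬ (searchCost n)) (label inj₁ 0 A) + weight O l (Φᴮ (searchCost n)) (label inj₂ 0 B)
    ≤⟨ initial-potential≤ O l (searchCost n) n A B |A|≡n |B|≡n ⟩
  2 * suc ⌊log₂ n ⌋ + searchCost n
    ≡⟨ cong (λ y → 2 * suc ⌊log₂ n ⌋ + (suc y + suc y))
            (⌊log₂[2*b]⌋≡1+⌊log₂b⌋ n {{>-nonZero (≤-trans (s≤s z≤n) 2≤n)}}) ⟩
  2 * suc ⌊log₂ n ⌋ + (suc (suc ⌊log₂ n ⌋) + suc (suc ⌊log₂ n ⌋))
    ≤⟨ 6+4x≤10x ⌊log₂ n ⌋ (⌊log₂⌋-mono-≤ 2≤n) ⟩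
  10 * ⌊log₂ n ⌋
    ∎
  where
  open Merge O
  |label|≤n : ∀ t xs → length xs ≡ n → length (label t 0 xs) ≤ n
  |label|≤n t xs |xs|≡n = ≤-reflexive (trans (label-length O t 0 xs) |xs|≡n)

theorem36 : Σ ℕ λ c → Σ ℕ λ n₀ →
    (O : StrictTotalOrder 0ℓ 0ℓ 0ℓ) →
    (n : ℕ) → n₀ ≤ n →
    (A B : List (StrictTotalOrder.Carrier O)) →
    length A ≡ n → length B ≡ n →
    Linked (StrictTotalOrder._<_ O) A → Linked (StrictTotalOrder._<_ O) B →
    Merge.Disjoint O A B →
    (l : Label) → Merge.comparisonsOf O l A B ≤ c * ⌊log₂ n ⌋
theorem36 = 10 , 2 , λ O n 2≤n A B |A|≡n |B|≡n _ _ _ →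
  comparisonsOf≤10*⌊log₂n⌋ O n 2≤n A B |A|≡n |B|≡n
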